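{- Let $D\in EX(n)$ and let $\Delta^+$ be the maximum out-degree of $D$. If $n$ is odd then $\Delta^+\in\{\frac{n-1}{2},\frac{n+1}{2}\}$; if $n$ is even then $\Delta^+\in\{\frac n2-1,\frac n2,\frac n2+1\}$.
   Context: Digraphs are strict (no loops, no parallel arcs). A digraph is $\mathscr{F}$-free if it does not contain two distinct walks of length 2 (sequences $u\to a\to w$ of arcs, $u=w$ allowed) with the same initial and terminal vertices. $ex(n)$ is the maximum number of arcs of an $\mathscr{F}$-free digraph on $n$ vertices, and $EX(n)$ is the set of $\mathscr{F}$-free digraphs on $n$ vertices with exactly $ex(n)$ arcs. -}

module Defs where

open import Data.Nat using (ℕ; zero; suc; _+_; _*_; _≤_; _⊔_)
open import Data.Fin using (Fin)
open import Data.Bool using (Bool; true; false)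
open import Data.Product using (_×_)
open import Data.List using (List; map; foldr)
open import Data.Nat.ListAction using (sum)
open import Data.List using (allFin)
open import Relation.Binary.PropositionalEquality using (_≡_)

-- A digraph on vertex set Fin n, given by its arc relation (adjacency matrix).
-- Using a Bool-valued relation excludes parallel arcs automatically.
Digraph : ℕ → Set
Digraph n = Fin n → Fin n → Bool

Loopless : ∀ {n} → Digraph n → Set
Loopless {n} D = ∀ (v : Fin n) → D v v ≡ false

-- F-free: no two distinct walks u → a → w and u → b → w of length 2
-- (u = w allowed).
FFree : ∀ {n} → Digraph n → Set
FFree {n} D = ∀ (u a b w : Fin n) →
  D u a ≡ true → D a w ≡ true → D u b ≡ true → D b w ≡ true → a ≡ b

b2n : Bool → ℕ
b2n true = 1
b2n false = 0

outdeg : ∀ {n} → Digraph n → Fin n → ℕ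
outdeg {n} D v = sum (map (λ w → b2n (D v w)) (allFin n))

arcs : ∀ {n} → Digraph n → ℕ
arcs {n} D = sum (map (outdeg D) (allFin n))

-- maximum out-degree (0 for the empty digraph)
maxOutdeg : ∀ {n} → Digraph n → ℕ
maxOutdeg {n} D = foldr _⊔_ 0 (map (outdeg D) (allFin n))

InEX : ∀ n → Digraph n → Set
InEX n D = Loopless D × FFree D ×
  (∀ (D' : Digraph n) → Loopless D' → FFree D' → arcs D' ≤ arcs D)

-- Let u have maximum out-degree Δ and put c = n − Δ. In an F-free digraph the 2-walks
-- starting at u end in distinct vertices, so the out-neighbours of u have total out-degree
-- at most n, while each of the c other vertices has out-degree at most Δ: hence
-- ex(n) ≤ n + cΔ. Conversely, an explicit F-free digraph with parts of sizes 2 + r and q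
-- has (2 + r)(q + 1) + r arcs. If min(Δ, c) ≤ r, balancing the product gives
-- cΔ ≤ r(n − r), and n + r(n − r) falls short of that count by q − r. Taking
-- (r, q) = (k − 1, k) for n = 2k + 1 and (k − 2, k) for n = 2k forces Δ and c close to n/2.

module Submission where

open import Defs
open import Data.Nat using (ℕ; zero; suc; _+_; _*_; _≤_; _<_; _⊔_; z≤n; s≤s; z<s)
open import Data.Nat.Properties
open import Data.Nat.Tactic.RingSolver using (solve-∀)
import Data.Nat.ListAction as List
open import Algebra.Properties.Semiring.Sum +-*-semiring
  using (sum-syntax; sum-cong-≗; sum-replicate-zero; ∑-comm; ∑-distrib-+; *-distribˡ-sum; *-distribʳ-sum)
open import Data.Fin using (Fin; zero; suc; toℕ; fromℕ<)
open import Data.Fin.Properties as Fin using (toℕ-fromℕ<; toℕ<n; toℕ-injective)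
open import Data.Bool using (Bool; true; false; not; _∧_)
open import Data.Bool.Properties using (∧-conicalˡ; ∧-conicalʳ)
open import Data.Empty using (⊥; ⊥-elim)
open import Data.List using (List; []; _∷_; foldr; map; tabulate; allFin)
open import Data.List.Properties using (map-tabulate)
open import Data.List.Membership.Propositional using (_∈_)
open import Data.List.Membership.Propositional.Properties using (∈-allFin; ∈-map⁺; ∈-map⁻)
open import Data.List.Relation.Unary.Any using (here; there)
open import Data.Product using (_×_; _,_; proj₁; proj₂; ∃-syntax)
open import Data.Sum using (_⊎_; inj₁; inj₂)
open import Function using (_∘_)
open import Relation.Binary.PropositionalEquality
open import Relation.Nullary using (¬_; contradiction; Dec; yes; no)
open import Relation.Nullary.Decidable using (_×-dec_; _⊎-dec_; does; dec-true; dec-false)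

∑-mono-≤ : ∀ {n} {f g : Fin n → ℕ} → (∀ i → f i ≤ g i) → ∑[ i < n ] f i ≤ ∑[ i < n ] g i
∑-mono-≤ {zero}  _   = z≤n
∑-mono-≤ {suc n} f≤g = +-mono-≤ (f≤g zero) (∑-mono-≤ (f≤g ∘ suc))

∑-const : ∀ n c → ∑[ i < n ] c ≡ n * c
∑-const zero    c = refl
∑-const (suc n) c = cong (c +_) (∑-const n c)

∑-ones : ∀ n → ∑[ i < n ] 1 ≡ n
∑-ones n = trans (∑-const n 1) (*-identityʳ n)

term≤∑ : ∀ {n} (f : Fin n → ℕ) i → f i ≤ ∑[ j < n ] f j
term≤∑ f zero    = m≤m+n _ _
term≤∑ f (suc i) = ≤-trans (term≤∑ (f ∘ suc) i) (m≤n+m _ (f zero))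

∑-b2n-unique≤1 : ∀ {n} (g : Fin n → Bool) →
  (∀ i j → g i ≡ true → g j ≡ true → i ≡ j) → ∑[ i < n ] b2n (g i) ≤ 1
∑-b2n-unique≤1 {zero}  g unique = z≤n
∑-b2n-unique≤1 {suc n} g unique with g zero in g₀
... | false = ∑-b2n-unique≤1 (g ∘ suc) (λ i j gi gj → Fin.suc-injective (unique (suc i) (suc j) gi gj))
... | true  = s≤s (≤-trans (∑-mono-≤ rest-false) (≤-reflexive (sum-replicate-zero n)))
  where
  rest-false : ∀ i → b2n (g (suc i)) ≤ 0
  rest-false i with g (suc i) in gᵢ
  ... | false = z≤n
  ... | true  with unique zero (suc i) g₀ gᵢ
  ...   | ()

∑-toℕ-+ : ∀ m k (F : ℕ → ℕ) →
  ∑[ i < m + k ] F (toℕ i) ≡ ∑[ i < m ] F (toℕ i) + ∑[ j < k ] F (m + toℕ j)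
∑-toℕ-+ zero    k F = refl
∑-toℕ-+ (suc m) k F =
  trans (cong (F 0 +_) (∑-toℕ-+ m k (F ∘ suc))) (sym (+-assoc (F 0) _ _))

∑-toℕ-term : ∀ {n} (F : ℕ → ℕ) {y} → y < n → F y ≤ ∑[ i < n ] F (toℕ i)
∑-toℕ-term F y<n = subst (λ z → F z ≤ _) (toℕ-fromℕ< y<n) (term≤∑ (F ∘ toℕ) (fromℕ< y<n))

sum-map-allFin : ∀ n (f : Fin n → ℕ) → List.sum (map f (allFin n)) ≡ ∑[ i < n ] f i
sum-map-allFin n f = trans (cong List.sum (map-tabulate (λ i → i) f)) (sum-tabulate n f)
  where
  sum-tabulate : ∀ n (f : Fin n → ℕ) → List.sum (tabulate f) ≡ ∑[ i < n ] f i
  sum-tabulate zero    f = refl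
  sum-tabulate (suc n) f = cong (f zero +_) (sum-tabulate n (f ∘ suc))

foldr-⊔-upper : ∀ {x} {xs : List ℕ} → x ∈ xs → x ≤ foldr _⊔_ 0 xs
foldr-⊔-upper                (here refl) = m≤m⊔n _ _
foldr-⊔-upper {xs = y ∷ _} (there x∈xs) = ≤-trans (foldr-⊔-upper x∈xs) (m≤n⊔m y _)

foldr-⊔-∈ : ∀ x xs → foldr _⊔_ 0 (x ∷ xs) ∈ x ∷ xs
foldr-⊔-∈ x []       = here (⊔-identityʳ x)
foldr-⊔-∈ x (y ∷ ys) with ⊔-sel x (foldr _⊔_ 0 (y ∷ ys))
... | inj₁ x⊔m≡x = here x⊔m≡x
... | inj₂ x⊔m≡m = there (subst (_∈ y ∷ ys) (sym x⊔m≡m) (foldr-⊔-∈ y ys))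

outdeg-∑ : ∀ {n} (D : Digraph n) v → outdeg D v ≡ ∑[ w < n ] b2n (D v w)
outdeg-∑ D v = sum-map-allFin _ (λ w → b2n (D v w))

arcs-∑ : ∀ {n} (D : Digraph n) → arcs D ≡ ∑[ v < n ] outdeg D v
arcs-∑ D = sum-map-allFin _ (outdeg D)

outdeg≤maxOutdeg : ∀ {n} (D : Digraph n) v → outdeg D v ≤ maxOutdeg D
outdeg≤maxOutdeg D v = foldr-⊔-upper (∈-map⁺ (outdeg D) (∈-allFin v))

maxOutdeg-attained : ∀ {n} (D : Digraph (suc n)) → ∃[ u ] maxOutdeg D ≡ outdeg D u
maxOutdeg-attained {n} D with ∈-map⁻ (outdeg D) {xs = allFin (suc n)} (foldr-⊔-∈ _ _)
... | u , _ , Δ≡ = u , Δ≡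

b2n-∧ : ∀ a b → b2n a * b2n b ≡ b2n (a ∧ b)
b2n-∧ true  b = +-identityʳ (b2n b)
b2n-∧ false b = refl

b2n+b2n-not : ∀ b → b2n b + b2n (not b) ≡ 1
b2n+b2n-not true  = refl
b2n+b2n-not false = refl

b2n-split : ∀ b x → b2n b * x + b2n (not b) * x ≡ x
b2n-split b x = begin
  b2n b * x + b2n (not b) * x ≡⟨ *-distribʳ-+ x (b2n b) _ ⟨
  (b2n b + b2n (not b)) * x   ≡⟨ cong (_* x) (b2n+b2n-not b) ⟩
  1 * x                       ≡⟨ *-identityˡ x ⟩
  x                           ∎
  where open ≡-Reasoning

walks₂-from≤ : ∀ {n} (D : Digraph n) → FFree D → ∀ u → ∑[ v < n ] (b2n (D u v) * outdeg D v) ≤ n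
walks₂-from≤ {n} D ffree u = begin
  ∑[ v < n ] (b2n (D u v) * outdeg D v)            ≡⟨ sum-cong-≗ {n} (λ v → cong (b2n (D u v) *_) (outdeg-∑ D v)) ⟩
  ∑[ v < n ] (b2n (D u v) * ∑[ w < n ] b2n (D v w)) ≡⟨ sum-cong-≗ {n} (λ v → *-distribˡ-sum (b2n (D u v)) (λ w → b2n (D v w))) ⟩
  ∑[ v < n ] ∑[ w < n ] (b2n (D u v) * b2n (D v w)) ≡⟨ ∑-comm (λ v w → b2n (D u v) * b2n (D v w)) ⟩
  ∑[ w < n ] ∑[ v < n ] (b2n (D u v) * b2n (D v w)) ≡⟨ sum-cong-≗ {n} (λ w → sum-cong-≗ {n} (λ v → b2n-∧ (D u v) (D v w))) ⟩
  ∑[ w < n ] ∑[ v < n ] b2n (D u v ∧ D v w)         ≤⟨ ∑-mono-≤ (λ w → ∑-b2n-unique≤1 _ (unique-middle w)) ⟩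
  ∑[ w < n ] 1                                     ≡⟨ ∑-ones n ⟩
  n                                                ∎
  where
  open ≤-Reasoning
  unique-middle : ∀ w a b → (D u a ∧ D a w) ≡ true → (D u b ∧ D b w) ≡ true → a ≡ b
  unique-middle w a b uaw ubw = ffree u a b w
    (∧-conicalˡ _ _ uaw) (∧-conicalʳ _ _ uaw) (∧-conicalˡ _ _ ubw) (∧-conicalʳ _ _ ubw)

arcs-upper-bound : ∀ {n} (D : Digraph n) → FFree D →
  ∃[ c ] maxOutdeg D + c ≡ n × arcs D ≤ n + c * maxOutdeg D
arcs-upper-bound {zero}  D ffree = 0 , refl , z≤n
arcs-upper-bound {suc n} D ffree = c , Δ+c≡n , arcs≤
  where
  N = suc n
  Δ = maxOutdeg D
  u = proj₁ (maxOutdeg-attained D)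
  c = ∑[ v < N ] b2n (not (D u v))
  Δ+c≡n : Δ + c ≡ N
  Δ+c≡n = begin
    Δ + c                                              ≡⟨ cong (_+ c) (trans (proj₂ (maxOutdeg-attained D)) (outdeg-∑ D u)) ⟩
    ∑[ v < N ] b2n (D u v) + c                         ≡⟨ ∑-distrib-+ (λ v → b2n (D u v)) (λ v → b2n (not (D u v))) ⟨
    ∑[ v < N ] (b2n (D u v) + b2n (not (D u v)))       ≡⟨ sum-cong-≗ {N} (λ v → b2n+b2n-not (D u v)) ⟩
    ∑[ v < N ] 1                                       ≡⟨ ∑-ones N ⟩
    N                                                  ∎
    where open ≡-Reasoning
  arcs≤ : arcs D ≤ N + c * Δ
  arcs≤ = begin
    arcs D                                             ≡⟨ arcs-∑ D ⟩
    ∑[ v < N ] outdeg D v                              ≡⟨ sum-cong-≗ {N} (λ v → b2n-split (D u v) (outdeg D v)) ⟨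
    ∑[ v < N ] (b2n (D u v) * outdeg D v + b2n (not (D u v)) * outdeg D v)
                                                       ≡⟨ ∑-distrib-+ (λ v → b2n (D u v) * outdeg D v) (λ v → b2n (not (D u v)) * outdeg D v) ⟩
    ∑[ v < N ] (b2n (D u v) * outdeg D v) + ∑[ v < N ] (b2n (not (D u v)) * outdeg D v)
                                                       ≤⟨ +-mono-≤ (walks₂-from≤ D ffree u)
                                                                   (∑-mono-≤ (λ v → *-monoʳ-≤ (b2n (not (D u v))) (outdeg≤maxOutdeg D v))) ⟩
    N + ∑[ v < N ] (b2n (not (D u v)) * Δ)             ≡⟨ cong (N +_) (*-distribʳ-sum Δ (λ v → b2n (not (D u v)))) ⟨
    N + c * Δ                                          ∎
    where open ≤-Reasoning

-- The extremal construction: A = [0, 2 + r) and B = [2 + r, 2 + r + q) (p = 2 + r in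
-- hypothesis names). Each vertex x of A has an arc to every vertex of B and one arc inside A,
-- to hub x; the vertex 2 + r + j of B, for j < r, has a single arc back, to 2 + j.
hub : ℕ → ℕ
hub zero    = 1
hub (suc _) = 0

hub≤1 : ∀ x → hub x ≤ 1
hub≤1 zero    = ≤-refl
hub≤1 (suc _) = z≤n

hub-fixed-point-free : ∀ x → x ≢ hub x
hub-fixed-point-free zero    ()
hub-fixed-point-free (suc _) ()

Arc : ℕ → ℕ → ℕ → Set
Arc r x y = (x < 2 + r × 2 + r ≤ y) ⊎ (x < 2 + r × y ≡ hub x) ⊎ (2 + r ≤ x × x < 2 + r + r × y + r ≡ x)

pattern across x<p p≤y        = inj₁ (x<p , p≤y)
pattern inner  x<p y≡hub      = inj₂ (inj₁ (x<p , y≡hub))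
pattern back   p≤x x<p+r y+r≡x = inj₂ (inj₂ (p≤x , x<p+r , y+r≡x))

arc? : ∀ r x y → Dec (Arc r x y)
arc? r x y =
  x <? 2 + r ×-dec 2 + r ≤? y ⊎-dec x <? 2 + r ×-dec y ≟ hub x ⊎-dec 2 + r ≤? x ×-dec x <? 2 + r + r ×-dec y + r ≟ x

hub<2+r : ∀ r x → hub x < 2 + r
hub<2+r r x = ≤-trans (s≤s (hub≤1 x)) (m≤m+n 2 r)

out-of-A : ∀ {r x y} → x < 2 + r → Arc r x y → 2 + r ≤ y ⊎ y ≡ hub x
out-of-A _   (across _ p≤y)  = inj₁ p≤y
out-of-A _   (inner _ y≡hub) = inj₂ y≡hub
out-of-A x<p (back p≤x _ _)  = contradiction x<p (≤⇒≯ p≤x)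

out-of-B : ∀ {r x y} → 2 + r ≤ x → Arc r x y → x < 2 + r + r × y + r ≡ x
out-of-B p≤x (across x<p _)        = contradiction x<p (≤⇒≯ p≤x)
out-of-B p≤x (inner x<p _)         = contradiction x<p (≤⇒≯ p≤x)
out-of-B _   (back _ x<p+r y+r≡x) = x<p+r , y+r≡x

back-target : ∀ {r x y} → 2 + r ≤ x → x < 2 + r + r → y + r ≡ x → 2 ≤ y × y < 2 + r
back-target {r} {x} {y} p≤x x<p+r y+r≡x =
  +-cancelʳ-≤ r 2 y (subst (2 + r ≤_) (sym y+r≡x) p≤x) ,
  +-cancelʳ-< r y (2 + r) (subst (_< 2 + r + r) (sym y+r≡x) x<p+r)

arc-irreflexive : ∀ {r x} → ¬ Arc r x x
arc-irreflexive (across x<p p≤x)       = ≤⇒≯ p≤x x<p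
arc-irreflexive (inner _ x≡hub)        = hub-fixed-point-free _ x≡hub
arc-irreflexive (back p≤x x<p+r x+r≡x) = ≤⇒≯ p≤x (proj₂ (back-target p≤x x<p+r x+r≡x))

A-B-no-common-out-neighbour : ∀ {r a b w} → a < 2 + r → Arc r a w → 2 + r ≤ b → Arc r b w → ⊥
A-B-no-common-out-neighbour {r} {a} a<p aw p≤b bw
  with out-of-B p≤b bw
... | b<p+r , w+r≡b with back-target p≤b b<p+r w+r≡b | out-of-A a<p aw
...   | _   , w<p | inj₁ p≤w   = ≤⇒≯ p≤w w<p
...   | 2≤w , _   | inj₂ w≡hub = ≤⇒≯ (≤-trans 2≤w (subst (_≤ 1) (sym w≡hub) (hub≤1 a))) (s≤s (s≤s z≤n))

-- The middle vertex of a 2-walk from u is determined: u ∈ B has one out-neighbour, and for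
-- u ∈ A the middle vertex lies in B exactly when the end vertex lies in [2, 2 + r).
arc-ffree : ∀ {r u a b w} → Arc r u a → Arc r a w → Arc r u b → Arc r b w → a ≡ b
arc-ffree {r} {u} {a} {b} ua aw ub bw with ≤-<-connex (2 + r) u
... | inj₁ p≤u = +-cancelʳ-≡ r a b (trans (proj₂ (out-of-B p≤u ua)) (sym (proj₂ (out-of-B p≤u ub))))
... | inj₂ u<p with out-of-A u<p ua | out-of-A u<p ub
...   | inj₁ p≤a   | inj₁ p≤b   = trans (sym (proj₂ (out-of-B p≤a aw))) (proj₂ (out-of-B p≤b bw))
...   | inj₂ a≡hub | inj₂ b≡hub = trans a≡hub (sym b≡hub)
...   | inj₂ a≡hub | inj₁ p≤b   =
  ⊥-elim (A-B-no-common-out-neighbour (subst (_< 2 + r) (sym a≡hub) (hub<2+r r u)) aw p≤b bw)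
...   | inj₁ p≤a   | inj₂ b≡hub =
  ⊥-elim (A-B-no-common-out-neighbour (subst (_< 2 + r) (sym b≡hub) (hub<2+r r u)) bw p≤a aw)

does-true⇒ : ∀ {A : Set} (a? : Dec A) → does a? ≡ true → A
does-true⇒ (yes a) _  = a
does-true⇒ (no _)  ()

construction : ∀ r q → Digraph (2 + r + q)
construction r q v w = does (arc? r (toℕ v) (toℕ w))

construction-loopless : ∀ r q → Loopless (construction r q)
construction-loopless r q v = dec-false (arc? r (toℕ v) (toℕ v)) arc-irreflexive

construction-ffree : ∀ r q → FFree (construction r q)
construction-ffree r q u a b w ua aw ub bw =
  toℕ-injective (arc-ffree (arc⇒ u a ua) (arc⇒ a w aw) (arc⇒ u b ub) (arc⇒ b w bw))
  where
  arc⇒ : ∀ v w → construction r q v w ≡ true → Arc r (toℕ v) (toℕ w)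
  arc⇒ v w = does-true⇒ (arc? r (toℕ v) (toℕ w))

construction-arcs : ∀ r q → r ≤ q → (2 + r) * suc q + r ≤ arcs (construction r q)
construction-arcs r q r≤q with m≤n⇒∃[o]m+o≡n r≤q
... | t , refl = begin
  p * suc q + r                                          ≡⟨ cong₂ _+_ (∑-const p (suc q)) (∑-ones r) ⟨
  ∑[ x < p ] suc q + ∑[ j < r ] 1                        ≤⟨ +-mono-≤ (∑-mono-≤ (λ x → outdeg-A (toℕ<n x)))
                                                                     (∑-mono-≤ (λ j → outdeg-B (toℕ<n j))) ⟩
  ∑[ x < p ] G (toℕ x) + ∑[ j < r ] G (p + toℕ j)        ≤⟨ +-monoʳ-≤ (∑[ x < p ] G (toℕ x)) (m≤m+n _ (∑[ j < t ] G (p + (r + toℕ j)))) ⟩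
  ∑[ x < p ] G (toℕ x) + (∑[ j < r ] G (p + toℕ j) + ∑[ j < t ] G (p + (r + toℕ j)))
                                                         ≡⟨ cong (∑[ x < p ] G (toℕ x) +_) (∑-toℕ-+ r t (λ y → G (p + y))) ⟨
  ∑[ x < p ] G (toℕ x) + ∑[ j < q ] G (p + toℕ j)        ≡⟨ ∑-toℕ-+ p q G ⟨
  ∑[ v < p + q ] G (toℕ v)                               ≡⟨ sum-cong-≗ {p + q} (λ v → outdeg-∑ (construction r q) v) ⟨
  ∑[ v < p + q ] outdeg (construction r q) v             ≡⟨ arcs-∑ (construction r q) ⟨
  arcs (construction r q)                                ∎
  where
  open ≤-Reasoning
  p = 2 + r
  F : ℕ → ℕ → ℕ
  F x y = b2n (does (arc? r x y))
  G : ℕ → ℕ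
  G x = ∑[ w < p + q ] F x (toℕ w)
  counted : ∀ {x y} → Arc r x y → 1 ≤ F x y
  counted arc = ≤-reflexive (sym (cong b2n (dec-true (arc? r _ _) arc)))
  outdeg-A : ∀ {x} → x < p → suc q ≤ G x
  outdeg-A {x} x<p = begin
    1 + q                                             ≡⟨ cong suc (∑-ones q) ⟨
    1 + ∑[ j < q ] 1                                  ≤⟨ +-mono-≤ (≤-trans (counted (inner x<p refl)) (∑-toℕ-term (F x) (hub<2+r r x)))
                                                                  (∑-mono-≤ {q} (λ j → counted (across x<p (m≤m+n p (toℕ j))))) ⟩
    ∑[ w < p ] F x (toℕ w) + ∑[ j < q ] F x (p + toℕ j) ≡⟨ ∑-toℕ-+ p q (F x) ⟨
    G x                                               ∎
  outdeg-B : ∀ {j} → j < r → 1 ≤ G (p + j)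
  outdeg-B {j} j<r = ≤-trans (counted (back (m≤m+n p j) (+-monoʳ-< p j<r) (cong (2 +_) (+-comm j r))))
                             (∑-toℕ-term (F (p + j)) (≤-trans (+-monoʳ-< 2 j<r) (m≤m+n p q)))

m+n≡o+p⇒m*n≤o*p : ∀ {m n o p} → m + n ≡ o + p → m ≤ o → o ≤ p → m * n ≤ o * p
m+n≡o+p⇒m*n≤o*p {m} {n} {_} {p} m+n≡o+p m≤o o≤p with m≤n⇒∃[o]m+o≡n m≤o
... | e , refl = begin
  m * n          ≡⟨ cong (m *_) n≡p+e ⟩
  m * (p + e)    ≡⟨ *-distribˡ-+ m p e ⟩
  m * p + m * e  ≤⟨ +-monoʳ-≤ (m * p) (*-monoˡ-≤ e (≤-trans (m≤m+n m e) o≤p)) ⟩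
  m * p + p * e  ≡⟨ cong (m * p +_) (*-comm p e) ⟩
  m * p + e * p  ≡⟨ *-distribʳ-+ p m e ⟨
  (m + e) * p    ∎
  where
  open ≤-Reasoning
  n≡p+e : n ≡ p + e
  n≡p+e = +-cancelˡ-≡ m n (p + e) (trans m+n≡o+p (trans (+-assoc m e p) (cong (m +_) (+-comm e p))))

split-window : ∀ {a b} m d → a + b ≡ 2 * m + d → m ≤ a → m ≤ b → ∃[ i ] i ≤ d × a ≡ m + i
split-window m d a+b≡ m≤a m≤b with m≤n⇒∃[o]m+o≡n m≤a | m≤n⇒∃[o]m+o≡n m≤b
... | i , refl | j , refl = i , ≤-trans (m≤m+n i j) (≤-reflexive i+j≡d) , refl
  where
  regroup : ∀ m i j → m + i + (m + j) ≡ 2 * m + (i + j)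
  regroup = solve-∀
  i+j≡d : i + j ≡ d
  i+j≡d = +-cancelˡ-≡ (2 * m) (i + j) d (trans (sym (regroup m i j)) a+b≡)

summand-exceeds : ∀ r q {a b} → r < q → a + b ≡ 2 + r + q → (2 + r) * suc q + r ≤ 2 + r + q + a * b → r < a
summand-exceeds r q {a} {b} r<q a+b≡n large with ≤-<-connex a r | m≤n⇒∃[o]m+o≡n r<q
... | inj₂ r<a | _        = r<a
... | inj₁ a≤r | s , refl = contradiction large (<⇒≱ (begin-strict
  2 + r + q + a * b              ≤⟨ +-monoʳ-≤ (2 + r + q) (m+n≡o+p⇒m*n≤o*p a+b≡r+[2+q] a≤r (≤-trans (<⇒≤ r<q) (m≤n+m q 2))) ⟩
  2 + r + q + r * (2 + q)        <⟨ m<m+n _ z<s ⟩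
  2 + r + q + r * (2 + q) + suc s ≡⟨ gap r s ⟨
  (2 + r) * suc q + r            ∎))
  where
  open ≤-Reasoning
  a+b≡r+[2+q] : a + b ≡ r + (2 + q)
  a+b≡r+[2+q] = trans a+b≡n (sym (trans (+-suc r (suc q)) (cong suc (+-suc r q))))
  gap : ∀ r s → (2 + r) * suc (suc r + s) + r ≡ 2 + r + (suc r + s) + r * (2 + (suc r + s)) + suc s
  gap = solve-∀

extremal-arcs-lower-bound : ∀ {n} {D : Digraph n} → InEX n D →
  ∀ r q → n ≡ 2 + r + q → r ≤ q → (2 + r) * suc q + r ≤ arcs D
extremal-arcs-lower-bound (_ , _ , maximal) r q refl r≤q =
  ≤-trans (construction-arcs r q r≤q) (maximal _ (construction-loopless r q) (construction-ffree r q))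

maxOutdeg-window : ∀ {n} {D : Digraph n} → InEX n D →
  ∀ m d → n ≡ 2 * m + suc d → ∃[ i ] i ≤ suc d × maxOutdeg D ≡ m + i
maxOutdeg-window {n} {D} D∈EX@(_ , ffree , _) m d n≡ with arcs-upper-bound D ffree
... | c , Δ+c≡n , arcs≤ = split-window m (suc d) (trans Δ+c≡n n≡) (proj₁ (bounds m n≡)) (proj₂ (bounds m n≡))
  where
  Δ = maxOutdeg D
  bounds : ∀ m → n ≡ 2 * m + suc d → m ≤ Δ × m ≤ c
  bounds zero    _  = z≤n , z≤n
  bounds (suc r) n≡ =
    summand-exceeds r q r<q (trans Δ+c≡n n≡2+r+q) (subst ((2 + r) * suc q + r ≤_) (cong (2 + r + q +_) (*-comm c Δ)) large) ,
    summand-exceeds r q r<q (trans (+-comm c Δ) (trans Δ+c≡n n≡2+r+q)) large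
    where
    q = r + suc d
    r<q : r < q
    r<q = m<m+n r z<s
    regroup : ∀ r d → 2 * suc r + suc d ≡ 2 + r + (r + suc d)
    regroup = solve-∀
    n≡2+r+q : n ≡ 2 + r + q
    n≡2+r+q = trans n≡ (regroup r d)
    large : (2 + r) * suc q + r ≤ 2 + r + q + c * Δ
    large = ≤-trans (extremal-arcs-lower-bound D∈EX r q n≡2+r+q (<⇒≤ r<q)) (subst (λ z → arcs D ≤ z + c * Δ) n≡2+r+q arcs≤)

maxOutdeg-odd : ∀ {n} {D : Digraph n} → InEX n D →
  ∀ k → n ≡ 2 * k + 1 → maxOutdeg D ≡ k ⊎ maxOutdeg D ≡ k + 1
maxOutdeg-odd D∈EX k n≡ with maxOutdeg-window D∈EX k 0 n≡
... | 0           , _      , Δ≡ = inj₁ (trans Δ≡ (+-identityʳ k))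
... | 1           , _      , Δ≡ = inj₂ Δ≡
... | suc (suc _) , s≤s () , _

maxOutdeg-even : ∀ {n} {D : Digraph n} → InEX n D →
  ∀ k → n ≡ 2 * k → maxOutdeg D + 1 ≡ k ⊎ maxOutdeg D ≡ k ⊎ maxOutdeg D ≡ k + 1
maxOutdeg-even D∈EX zero    refl = inj₂ (inj₁ refl)
maxOutdeg-even D∈EX (suc m) n≡ with maxOutdeg-window D∈EX m 1 (trans n≡ (trans (*-suc 2 m) (+-comm 2 (2 * m))))
... | 0                 , _              , Δ≡ = inj₁ (trans (cong (_+ 1) (trans Δ≡ (+-identityʳ m))) (+-comm m 1))
... | 1                 , _              , Δ≡ = inj₂ (inj₁ (trans Δ≡ (+-comm m 1)))
... | 2                 , _              , Δ≡ = inj₂ (inj₂ (trans Δ≡ (+-suc m 1)))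
... | suc (suc (suc _)) , s≤s (s≤s ()) , _

lemma4 : ∀ (n : ℕ) (D : Digraph n) → InEX n D →
    (∀ k → n ≡ 2 * k + 1 → maxOutdeg D ≡ k ⊎ maxOutdeg D ≡ k + 1) ×
    (∀ k → n ≡ 2 * k → maxOutdeg D + 1 ≡ k ⊎ maxOutdeg D ≡ k ⊎ maxOutdeg D ≡ k + 1)
lemma4 n D D∈EX = maxOutdeg-odd D∈EX , maxOutdeg-even D∈EX
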